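{- Fix $k\ge 1$, let $\pi$ be an input permutation for the $\mathfrak{D}^k\mathfrak{I}$ machine and let $a<b<c$ be elements of $\pi$. Consider, during a run of the machine on $\pi$ (a sequence of legal operations), the instant when $b$ is pushed into the increasing stack $I$. If at that instant any of the following holds: (1) $c$ is in $D_j$ and $a$ is in $D_l$ for some indices $l\le j$; (2) $c$ is in $D_j$ for some $j$, and $a$ is still in the input; (3) $c$ and $a$ are both still in the input, with $a$ following $c$ in $\pi$; then no continuation of the run by legal operations produces the sorted output $12\cdots n$.
   Context: The $\mathfrak{D}^k\mathfrak{I}$ machine consists of $k$ stacks $D_1,\dots,D_k$ in series ("decreasing stacks": elements in decreasing order from top to bottom, top is largest), followed by a stack $I$ ("increasing stack": elements in increasing order from top to bottom, top is smallest). The input permutation $\pi=\pi_1\cdots\pi_n$ is read left to right. Operations: $d_0$: push the next input element into $D_1$; $d_i$ ($1\le i\le k-1$): pop from $D_i$ and push into $D_{i+1}$; $d_k$: pop from $D_k$ and push into $I$; $d_{k+1}$: pop from $I$ and append to the output. An operation is legal if it respects the stack order restrictions; $d_{k+1}$ is considered legal if it outputs the smallest element not yet output, or if no other operation is legal. A run sorts $\pi$ if the final output is $12\cdots n$. -}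

module Defs where

open import Data.Nat using (ℕ; zero; suc; _<_; _≤_)
open import Data.Fin using (Fin; zero; suc; toℕ; inject₁; fromℕ)
open import Data.List using (List; []; _∷_; _++_; [_]; applyUpTo)
open import Data.List.Membership.Propositional using (_∈_; _∉_)
open import Data.Vec using (Vec; lookup; replicate; _[_]≔_)
open import Data.Unit using (⊤)
open import Data.Product using (Σ; ∃; ∃-syntax; _×_; _,_)
open import Data.Sum using (_⊎_)
open import Relation.Nullary using (¬_)
open import Relation.Binary.PropositionalEquality using (_≡_)
open import Relation.Binary.Construct.Closure.ReflexiveTransitive using (Star)

-- The D^k I machine with k = suc m decreasing stacks D_1 … D_k,
-- represented as  D : Vec (List ℕ) (suc m)  with D_1 = index zero and
-- D_k = index (fromℕ m).  Stacks are lists whose head is the top.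

CanPushD : ℕ → List ℕ → Set
CanPushD x []      = ⊤
CanPushD x (y ∷ _) = y < x

CanPushI : ℕ → List ℕ → Set
CanPushI x []      = ⊤
CanPushI x (y ∷ _) = x < y

record Config (m : ℕ) : Set where
  constructor config
  field
    input : List ℕ              -- remaining input, next element first
    D     : Vec (List ℕ) (suc m)
    I     : List ℕ
    out   : List ℕ              -- output so far, in order of output
open Config public

initial : (m : ℕ) → List ℕ → Config m
initial m π = config π (replicate (suc m) []) [] []

-- operations d_0, d_i (1 ≤ i ≤ k-1, indexed by Fin m), d_k, d_{k+1}
data Op (m : ℕ) : Set where
  d0   : Op m
  dmid : Fin m → Op m      -- dmid i : D_{i+1} → D_{i+2}  (i.e. from index inject₁ i to suc i)
  dk   : Op m
  dout : Op m

Legal0 : ∀ {m} → Config m → Set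
Legal0 C = ∃[ x ] ∃[ r ] (input C ≡ x ∷ r × CanPushD x (lookup (D C) zero))

LegalMid : ∀ {m} → Fin m → Config m → Set
LegalMid i C = ∃[ x ] ∃[ s ] (lookup (D C) (inject₁ i) ≡ x ∷ s × CanPushD x (lookup (D C) (suc i)))

LegalK : ∀ {m} → Config (m) → Set
LegalK {m} C = ∃[ x ] ∃[ s ] (lookup (D C) (fromℕ m) ≡ x ∷ s × CanPushI x (I C))

NoOtherLegal : ∀ {m} → Config m → Set
NoOtherLegal C = ¬ Legal0 C × (∀ i → ¬ LegalMid i C) × ¬ LegalK C

SmallestNotOutput : List ℕ → ∀ {m} → Config m → ℕ → Set
SmallestNotOutput π C x = ∀ y → y ∈ π → y ∉ out C → x ≤ y

data Step (π : List ℕ) {m : ℕ} : Op m → Config m → Config m → Set where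
  step0   : ∀ {x r D I o} → CanPushD x (lookup D zero) →
            Step π d0 (config (x ∷ r) D I o)
                      (config r (D [ zero ]≔ (x ∷ lookup D zero)) I o)
  stepMid : ∀ {i x s inp D I o} → lookup D (inject₁ i) ≡ x ∷ s →
            CanPushD x (lookup D (suc i)) →
            Step π (dmid i) (config inp D I o)
                   (config inp ((D [ inject₁ i ]≔ s) [ suc i ]≔ (x ∷ lookup D (suc i))) I o)
  stepK   : ∀ {x s inp D I o} → lookup D (fromℕ m) ≡ x ∷ s → CanPushI x I →
            Step π dk (config inp D I o)
                      (config inp (D [ fromℕ m ]≔ s) (x ∷ I) o)
  stepOut : ∀ {x inp D I o} →
            (SmallestNotOutput π (config inp D (x ∷ I) o) x
              ⊎ NoOtherLegal (config inp D (x ∷ I) o)) →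
            Step π dout (config inp D (x ∷ I) o)
                        (config inp D I (o ++ [ x ]))

AnyStep : (π : List ℕ) {m : ℕ} → Config m → Config m → Set
AnyStep π C C′ = ∃[ op ] Step π op C C′

Run : (π : List ℕ) {m : ℕ} → Config m → Config m → Set
Run π = Star (AnyStep π)

idPerm : ℕ → List ℕ
idPerm n = applyUpTo suc n

module Submission where

-- Call the input and decreasing stacks of a configuration
-- *blocked* when c lies in some stack D_j and a lies in a stack D_l with l ≤ j
-- or is still unread, or when both are unread with c read first: these are
-- the three hypotheses of the theorem, so the configuration is blocked when b
-- enters I.  While b stays in I, every legal operation keeps it blocked: c can
-- never be moved to I (it would have to go on top of b, but b < c), and a can
-- never overtake c (it would have to be the top of a decreasing stack that also
-- contains c, but a < c).  So a is never output while b is in I.  Along a run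
-- whose output is 1 2 ⋯ n, b therefore cannot be output (a < b would have to
-- come first), and if b stays in I until the end then c is never output.

open import Defs
open import Data.Nat using (ℕ; suc; _<_; _≤_; _>_; z≤n; s≤s)
open import Data.Nat.Properties using (_≟_; <-trans; <-irrefl; <-asym; <⇒≢; ≤-antisym; 1+n≢n; m≤n⇒m<n∨m≡n)
open import Data.Fin using (Fin; zero; suc; toℕ; fromℕ; inject₁)
open import Data.Fin.Properties using (toℕ-inject₁; toℕ-injective; ≤fromℕ; i≤inject₁[j]⇒i≤1+j)
import Data.Fin.Properties as Fin
open import Data.List using (List; []; _∷_; _++_; [_])
open import Data.List.Properties using (++-assoc; ++-identityʳ; ∷-injectiveˡ; ∷-injectiveʳ)
open import Data.List.Membership.Propositional using (_∈_; _∉_)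
open import Data.List.Membership.Propositional.Properties using (∈-++⁺ˡ; ∈-++⁺ʳ)
open import Data.List.Relation.Unary.Any using (here; there)
import Data.List.Relation.Unary.Any as Any
open import Data.List.Relation.Unary.All using ([]; _∷_)
import Data.List.Relation.Unary.All as All
import Data.List.Relation.Unary.All.Properties as All
open import Data.List.Relation.Unary.AllPairs using (AllPairs; []; _∷_)
import Data.List.Relation.Unary.AllPairs as AllPairs
import Data.List.Relation.Unary.AllPairs.Properties as AllPairs
open import Data.List.Relation.Unary.Unique.Propositional using (Unique)
open import Data.List.Relation.Binary.Permutation.Propositional using (_↭_; ↭-refl; ↭-sym; ↭-trans; ↭-reflexive; ↭⇒↭ₛ)
open import Data.List.Relation.Binary.Permutation.Propositional.Properties using (∈-resp-↭; shift; ++⁺ˡ; ++⁺ʳ; ++-comm)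
open import Data.List.Relation.Binary.Permutation.Setoid.Properties using (Unique-resp-↭)
open import Data.Vec using (Vec; []; _∷_; lookup; replicate; _[_]≔_)
open import Data.Vec.Properties using (lookup∘update; lookup∘update′; lookup-replicate)
open import Data.Product using (∃-syntax; _×_; _,_)
open import Data.Sum using (_⊎_; inj₁; inj₂)
open import Data.Empty using (⊥; ⊥-elim)
open import Function using (_∘_)
open import Level using (0ℓ)
open import Relation.Binary using (Rel; Transitive)
open import Relation.Binary.PropositionalEquality using (_≡_; _≢_; refl; sym; trans; cong; subst; setoid)
open import Relation.Binary.Construct.Closure.ReflexiveTransitive using (ε; _◅_)
open import Relation.Nullary using (¬_; yes; no)

unique-resp-↭ : ∀ {xs ys : List ℕ} → xs ↭ ys → Unique xs → Unique ys
unique-resp-↭ p = Unique-resp-↭ (setoid ℕ) (↭⇒↭ₛ p)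

unique-disjoint : ∀ (xs : List ℕ) {ys y} → Unique (xs ++ ys) → y ∈ xs → y ∈ ys → ⊥
unique-disjoint (x ∷ xs) (x∉ ∷ _) (here refl) y∈ys = All.lookup x∉ (∈-++⁺ʳ xs y∈ys) refl
unique-disjoint (x ∷ xs) (_ ∷ u) (there y∈xs) y∈ys = unique-disjoint xs u y∈xs y∈ys

unique-++ˡ : ∀ (xs : List ℕ) {ys} → Unique (xs ++ ys) → Unique xs
unique-++ˡ []       _        = []
unique-++ˡ (_ ∷ xs) (x∉ ∷ u) = All.++⁻ˡ xs x∉ ∷ unique-++ˡ xs u

unique-++ʳ : ∀ (xs : List ℕ) {ys} → Unique (xs ++ ys) → Unique ys
unique-++ʳ []       u       = u
unique-++ʳ (_ ∷ xs) (_ ∷ u) = unique-++ʳ xs u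

suffix-split : ∀ (p : List ℕ) {q} xs {c w} → p ++ q ≡ xs ++ c ∷ w → c ∉ p →
               ∃[ xs′ ] (q ≡ xs′ ++ c ∷ w)
suffix-split []      xs       e c∉p = xs , e
suffix-split (y ∷ p) []       e c∉p = ⊥-elim (c∉p (here (sym (∷-injectiveˡ e))))
suffix-split (y ∷ p) (z ∷ xs) e c∉p =
  suffix-split p xs (∷-injectiveʳ e) (c∉p ∘ there)

Decreasing : List ℕ → Set
Decreasing = AllPairs _>_

Increasing : List ℕ → Set
Increasing = AllPairs _<_

push-sorted : ∀ {R : Rel ℕ 0ℓ} → Transitive R → ∀ {x y u} →
              R x y → AllPairs R (y ∷ u) → AllPairs R (x ∷ y ∷ u)
push-sorted R-trans xRy sorted@(yRu ∷ _) = (xRy ∷ All.map (R-trans xRy) yRu) ∷ sorted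

pushD-sorted : ∀ {x u} → CanPushD x u → Decreasing u → Decreasing (x ∷ u)
pushD-sorted {u = []}    _   _      = [] ∷ []
pushD-sorted {u = _ ∷ _} y<x sorted = push-sorted (λ y<x z<y → <-trans z<y y<x) y<x sorted

pushI-sorted : ∀ {x u} → CanPushI x u → Increasing u → Increasing (x ∷ u)
pushI-sorted {u = []}    _   _      = [] ∷ []
pushI-sorted {u = _ ∷ _} x<y sorted = push-sorted <-trans x<y sorted

pop-sorted : ∀ {R : Rel ℕ 0ℓ} {L x s} → L ≡ x ∷ s → AllPairs R L → AllPairs R s
pop-sorted refl = AllPairs.tail

canPushI⇒< : ∀ {x y u} → Increasing u → CanPushI x u → y ∈ u → x < y
canPushI⇒< sorted x-fits y∈u = All.lookup (AllPairs.head (pushI-sorted x-fits sorted)) y∈u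

below-top : ∀ {x y s} → Decreasing (x ∷ s) → y ∈ x ∷ s → y ≢ x → y < x
below-top (x>s ∷ _) y∈ y≢x = All.lookup x>s (Any.tail y≢x y∈)

idPerm-increasing : ∀ n → Increasing (idPerm n)
idPerm-increasing n = AllPairs.applyUpTo⁺₁ suc n (λ i<j _ → s≤s i<j)

idPerm-unique : ∀ n → Unique (idPerm n)
idPerm-unique n = AllPairs.map <⇒≢ (idPerm-increasing n)

sorted-prefix : ∀ o {x t y} → Increasing (o ++ x ∷ t) → y ∈ o ++ x ∷ t → y < x → y ∈ o
sorted-prefix []      _          (here refl)  y<x = ⊥-elim (<-irrefl refl y<x)
sorted-prefix []      (x<t ∷ _)  (there y∈t)  y<x = ⊥-elim (<-asym y<x (All.lookup x<t y∈t))
sorted-prefix (z ∷ o) _          (here y≡z)   _   = here y≡z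
sorted-prefix (z ∷ o) (_ ∷ rest) (there y∈)   y<x = there (sorted-prefix o rest y∈ y<x)

smaller-output-first : ∀ {n} o {x t y} → (o ++ [ x ]) ++ t ≡ idPerm n →
                       y ∈ idPerm n → y < x → y ∈ o
smaller-output-first {n} o {x} {t} prefix y∈ y<x =
  sorted-prefix o (subst Increasing (sym split) (idPerm-increasing n))
                (subst (_ ∈_) (sym split) y∈) y<x
  where
  split : o ++ x ∷ t ≡ idPerm n
  split = trans (sym (++-assoc o [ x ] t)) prefix

contents : ∀ {k} → Vec (List ℕ) k → List ℕ
contents []      = []
contents (s ∷ S) = s ++ contents S

contents-empty : ∀ k → contents (replicate k []) ≡ []
contents-empty 0       = refl
contents-empty (suc k) = contents-empty k

∈-contents : ∀ {k} (S : Vec (List ℕ) k) j {y} → y ∈ lookup S j → y ∈ contents S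
∈-contents (s ∷ S) zero    y∈ = ∈-++⁺ˡ y∈
∈-contents (s ∷ S) (suc j) y∈ = ∈-++⁺ʳ s (∈-contents S j y∈)

contents-push : ∀ {k} (S : Vec (List ℕ) k) i {u} x → lookup S i ≡ u →
                x ∷ contents S ↭ contents (S [ i ]≔ (x ∷ u))
contents-push (s ∷ S) zero    x refl = ↭-refl
contents-push (s ∷ S) (suc i) x e    =
  ↭-trans (↭-sym (shift x s (contents S))) (++⁺ˡ s (contents-push S i x e))

contents-pop : ∀ {k} (S : Vec (List ℕ) k) i {x s} → lookup S i ≡ x ∷ s →
               contents S ↭ x ∷ contents (S [ i ]≔ s)
contents-pop (t ∷ S) zero    refl = ↭-refl
contents-pop (t ∷ S) (suc i) {x} e =
  ↭-trans (++⁺ˡ t (contents-pop S i e)) (shift x t _)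

stack-position : ∀ {k} (S : Vec (List ℕ) k) {y} i j → Unique (contents S) →
                 y ∈ lookup S i → y ∈ lookup S j → i ≡ j
stack-position (s ∷ S) zero    zero    u y∈i y∈j = refl
stack-position (s ∷ S) zero    (suc j) u y∈i y∈j = ⊥-elim (unique-disjoint s u y∈i (∈-contents S j y∈j))
stack-position (s ∷ S) (suc i) zero    u y∈i y∈j = ⊥-elim (unique-disjoint s u y∈j (∈-contents S i y∈i))
stack-position (s ∷ S) (suc i) (suc j) u y∈i y∈j = cong suc (stack-position S i j (unique-++ʳ s u) y∈i y∈j)

∈-update : ∀ {k} (S : Vec (List ℕ) k) i {v j y} →
           (i ≡ j → y ∈ v) → (i ≢ j → y ∈ lookup S j) → y ∈ lookup (S [ i ]≔ v) j
∈-update S i {j = j} at-i elsewhere with i Fin.≟ j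
... | yes refl = subst (_ ∈_) (sym (lookup∘update i S _)) (at-i refl)
... | no i≢j   = subst (_ ∈_) (sym (lookup∘update′ (i≢j ∘ sym) S _)) (elsewhere i≢j)

all-update : ∀ {k} {P : List ℕ → Set} (S : Vec (List ℕ) k) i {v} →
             (∀ j → P (lookup S j)) → P v → ∀ j → P (lookup (S [ i ]≔ v) j)
all-update {P = P} S i all-P P-v j with i Fin.≟ j
... | yes refl = subst P (sym (lookup∘update i S _)) P-v
... | no i≢j   = subst P (sym (lookup∘update′ (i≢j ∘ sym) S _)) (all-P j)

∈-pushed : ∀ {k} (S : Vec (List ℕ) k) i {u} x → x ∈ lookup (S [ i ]≔ (x ∷ u)) i
∈-pushed S i x = subst (x ∈_) (sym (lookup∘update i S _)) (here refl)

∈-push : ∀ {k} (S : Vec (List ℕ) k) i {u j y} x → lookup S i ≡ u →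
         y ∈ lookup S j → y ∈ lookup (S [ i ]≔ (x ∷ u)) j
∈-push S i x refl y∈ = ∈-update S i (λ { refl → there y∈ }) (λ _ → y∈)

∈-pop : ∀ {k} (S : Vec (List ℕ) k) i {x s j y} → lookup S i ≡ x ∷ s →
        y ∈ lookup S j → y ≢ x → y ∈ lookup (S [ i ]≔ s) j
∈-pop S i top y∈ y≢x =
  ∈-update S i (λ { refl → Any.tail y≢x (subst (_ ∈_) top y∈) }) (λ _ → y∈)

transfer : ∀ {k} → Vec (List ℕ) (suc k) → Fin k → ℕ → List ℕ → Vec (List ℕ) (suc k)
transfer S i x s = (S [ inject₁ i ]≔ s) [ suc i ]≔ (x ∷ lookup S (suc i))

suc≢inject₁ : ∀ {k} (i : Fin k) → suc i ≢ inject₁ i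
suc≢inject₁ i e = 1+n≢n (trans (cong toℕ e) (toℕ-inject₁ i))

∈-transferred : ∀ {k} (S : Vec (List ℕ) (suc k)) i {x s} → x ∈ lookup (transfer S i x s) (suc i)
∈-transferred S i {x} {s} = ∈-pushed (S [ inject₁ i ]≔ s) (suc i) x

next-unchanged : ∀ {k} (S : Vec (List ℕ) (suc k)) i s →
                 lookup (S [ inject₁ i ]≔ s) (suc i) ≡ lookup S (suc i)
next-unchanged S i s = lookup∘update′ (suc≢inject₁ i) S s

contents-transfer : ∀ {k} (S : Vec (List ℕ) (suc k)) i {x s} →
                    lookup S (inject₁ i) ≡ x ∷ s → contents S ↭ contents (transfer S i x s)
contents-transfer S i {x} {s} top =
  ↭-trans (contents-pop S (inject₁ i) top)
          (contents-push (S [ inject₁ i ]≔ s) (suc i) x (next-unchanged S i s))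

∈-transfer : ∀ {k} (S : Vec (List ℕ) (suc k)) i {x s j y} → lookup S (inject₁ i) ≡ x ∷ s →
             y ∈ lookup S j → y ≢ x → y ∈ lookup (transfer S i x s) j
∈-transfer S i {x} {s} top y∈ y≢x =
  ∈-push (S [ inject₁ i ]≔ s) (suc i) x (next-unchanged S i s) (∈-pop S (inject₁ i) top y∈ y≢x)

module Machine (m : ℕ) (π : List ℕ) where

  flat : Config m → List ℕ
  flat C = input C ++ contents (D C) ++ I C ++ out C

  record WellFormed (C : Config m) : Set where
    field
      consumed   : ∃[ p ] (p ++ input C ≡ π)
      distinct   : Unique (flat C)
      decreasing : ∀ j → Decreasing (lookup (D C) j)
      increasing : Increasing (I C)
  open WellFormed public

  step-rearranges : ∀ {op} {C C′ : Config m} → Step π op C C′ → flat C ↭ flat C′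
  step-rearranges (step0 {x} {r} {S} {Is} {o} _) =
    ↭-trans (↭-sym (shift x r (contents S ++ Is ++ o)))
            (++⁺ˡ r (++⁺ʳ (Is ++ o) (contents-push S zero x refl)))
  step-rearranges (stepMid {i} {inp = inp} {S} {Is} {o} top _) =
    ++⁺ˡ inp (++⁺ʳ (Is ++ o) (contents-transfer S i top))
  step-rearranges (stepK {x} {s} {inp} {S} {Is} {o} top _) =
    ++⁺ˡ inp (↭-trans (++⁺ʳ (Is ++ o) (contents-pop S (fromℕ m) top))
                      (↭-sym (shift x (contents (S [ fromℕ m ]≔ s)) (Is ++ o))))
  step-rearranges (stepOut {x} {inp} {S} {Is} {o} _) =
    ++⁺ˡ inp (++⁺ˡ (contents S) (↭-trans (++-comm [ x ] (Is ++ o))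
                                         (↭-reflexive (++-assoc Is o [ x ]))))

  read-one : ∀ {x r} → ∃[ p ] (p ++ x ∷ r ≡ π) → ∃[ p ] (p ++ r ≡ π)
  read-one {x} {r} (p , e) = p ++ [ x ] , trans (++-assoc p [ x ] r) e

  step-wf : ∀ {op} {C C′ : Config m} → WellFormed C → Step π op C C′ → WellFormed C′
  step-wf wf st@(step0 {D = S} x-fits) = record
    { consumed   = read-one (consumed wf)
    ; distinct   = unique-resp-↭ (step-rearranges st) (distinct wf)
    ; decreasing = all-update {P = Decreasing} S zero (decreasing wf)
                     (pushD-sorted x-fits (decreasing wf zero))
    ; increasing = increasing wf }
  step-wf wf st@(stepMid {i} {s = s} {D = S} top x-fits) = record
    { consumed   = consumed wf
    ; distinct   = unique-resp-↭ (step-rearranges st) (distinct wf)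
    ; decreasing = all-update {P = Decreasing} (S [ inject₁ i ]≔ s) (suc i)
                     (all-update {P = Decreasing} S (inject₁ i) (decreasing wf)
                        (pop-sorted top (decreasing wf (inject₁ i))))
                     (pushD-sorted x-fits (decreasing wf (suc i)))
    ; increasing = increasing wf }
  step-wf wf st@(stepK {D = S} top x-fits) = record
    { consumed   = consumed wf
    ; distinct   = unique-resp-↭ (step-rearranges st) (distinct wf)
    ; decreasing = all-update {P = Decreasing} S (fromℕ m) (decreasing wf)
                     (pop-sorted top (decreasing wf (fromℕ m)))
    ; increasing = pushI-sorted x-fits (increasing wf) }
  step-wf wf st@(stepOut _) = record
    { consumed   = consumed wf
    ; distinct   = unique-resp-↭ (step-rearranges st) (distinct wf)
    ; decreasing = decreasing wf
    ; increasing = AllPairs.tail (increasing wf) }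

  run-wf : ∀ {C C′ : Config m} → WellFormed C → Run π C C′ → WellFormed C′
  run-wf wf ε               = wf
  run-wf wf ((_ , st) ◅ run) = run-wf (step-wf wf st) run

  initial-wf : Unique π → WellFormed (initial m π)
  initial-wf distinct-π = record
    { consumed   = [] , refl
    ; distinct   = subst Unique (sym flat-initial) distinct-π
    ; decreasing = λ j → subst Decreasing (sym (lookup-replicate j [])) []
    ; increasing = [] }
    where
    flat-initial : flat (initial m π) ≡ π
    flat-initial = trans (cong (λ z → π ++ z ++ []) (contents-empty (suc m))) (++-identityʳ π)

  step-extends-output : ∀ {op} {C C′ : Config m} {L} → Step π op C C′ →
                        ∃[ t ] (out C′ ++ t ≡ L) → ∃[ t ] (out C ++ t ≡ L)
  step-extends-output (step0 _)     grows = grows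
  step-extends-output (stepMid _ _) grows = grows
  step-extends-output (stepK _ _)   grows = grows
  step-extends-output (stepOut {x} {o = o} _) (t , e) = x ∷ t , trans (sym (++-assoc o [ x ] t)) e

  run-extends-output : ∀ {C C′ : Config m} → Run π C C′ → ∃[ t ] (out C ++ t ≡ out C′)
  run-extends-output {C} ε                = [] , ++-identityʳ (out C)
  run-extends-output     ((_ , st) ◅ run) = step-extends-output st (run-extends-output run)

  Pending : Config m → ℕ → Set
  Pending C y = y ∈ input C ⊎ ∃[ j ] (y ∈ lookup (D C) j)

  pending-not-output : ∀ {C y} → WellFormed C → Pending C y → y ∉ out C
  pending-not-output {C} wf (inj₁ y∈input) y∈out =
    unique-disjoint (input C) (distinct wf) y∈input
      (∈-++⁺ʳ (contents (D C)) (∈-++⁺ʳ (I C) y∈out))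
  pending-not-output {C} wf (inj₂ (j , y∈Dj)) y∈out =
    unique-disjoint (contents (D C)) (unique-++ʳ (input C) (distinct wf))
      (∈-contents (D C) j y∈Dj) (∈-++⁺ʳ (I C) y∈out)

  stacks-distinct : ∀ {C} → WellFormed C → Unique (contents (D C))
  stacks-distinct {C} wf = unique-++ˡ (contents (D C)) (unique-++ʳ (input C) (distinct wf))

  module Pattern {a b c : ℕ} (a<b : a < b) (b<c : b < c) where

    a<c : a < c
    a<c = <-trans a<b b<c

    c≢a : c ≢ a
    c≢a c≡a = <-irrefl (sym c≡a) a<c

    data Blocked (inp : List ℕ) (S : Vec (List ℕ) (suc m)) : Set where
      stacked : ∀ j l → toℕ l ≤ toℕ j → c ∈ lookup S j → a ∈ lookup S l → Blocked inp S
      queued  : ∀ j → c ∈ lookup S j → a ∈ inp → Blocked inp S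
      ordered : ∀ xs ys zs → inp ≡ xs ++ c ∷ ys ++ a ∷ zs → Blocked inp S

    a-pending : ∀ C → Blocked (input C) (D C) → Pending C a
    a-pending _ (stacked _ l _ _ a∈) = inj₂ (l , a∈)
    a-pending _ (queued _ _ a∈)      = inj₁ a∈
    a-pending _ (ordered xs ys _ e)  =
      inj₁ (subst (a ∈_) (sym e) (∈-++⁺ʳ xs (there (∈-++⁺ʳ ys (here refl)))))

    c-pending : ∀ C → Blocked (input C) (D C) → Pending C c
    c-pending _ (stacked j _ _ c∈ _) = inj₂ (j , c∈)
    c-pending _ (queued j c∈ _)      = inj₂ (j , c∈)
    c-pending _ (ordered xs _ _ e)   = inj₁ (subst (c ∈_) (sym e) (∈-++⁺ʳ xs (here refl)))

    a-not-above-c : ∀ {L x s} → Decreasing L → L ≡ x ∷ s → c ∈ L → a ≢ x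
    a-not-above-c sorted refl c∈ refl = <-asym a<c (below-top sorted c∈ c≢a)

    -- d₀: a read a lands in D₁, weakly below c; a read c lands above the unread a.
    blocked-d0 : ∀ {x r S} → Blocked (x ∷ r) S → Blocked r (S [ zero ]≔ (x ∷ lookup S zero))
    blocked-d0 {x} {S = S} (stacked j l l≤j c∈ a∈) =
      stacked j l l≤j (∈-push S zero x refl c∈) (∈-push S zero x refl a∈)
    blocked-d0 {x} {S = S} (queued j c∈ (here a≡x)) =
      stacked j zero z≤n (∈-push S zero x refl c∈) (subst (_∈ _) (sym a≡x) (∈-pushed S zero x))
    blocked-d0 {x} {S = S} (queued j c∈ (there a∈)) = queued j (∈-push S zero x refl c∈) a∈
    blocked-d0 {x} {S = S} (ordered [] ys zs e) =
      queued zero (subst (_∈ _) (∷-injectiveˡ e) (∈-pushed S zero x))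
                  (subst (a ∈_) (sym (∷-injectiveʳ e)) (∈-++⁺ʳ ys (here refl)))
    blocked-d0 (ordered (_ ∷ xs) ys zs e) = ordered xs ys zs (∷-injectiveʳ e)

    -- An operation d_i with 1 ≤ i < k moves the top x of D_i to D_{i+1}: if
    -- x = c, c moves further right; if x = a, a was in a stack strictly left of
    -- c's, as being in the same stack would put a on top of c.
    blocked-dmid : ∀ {i x s inp S Is o} → WellFormed (config inp S Is o) →
                   lookup S (inject₁ i) ≡ x ∷ s → Blocked inp S → Blocked inp (transfer S i x s)
    blocked-dmid _ _ (ordered xs ys zs e) = ordered xs ys zs e
    blocked-dmid {i} {x} {S = S} _ top (queued j c∈ a∈) with c ≟ x
    ... | yes refl = queued (suc i) (∈-transferred S i) a∈
    ... | no c≢x   = queued j (∈-transfer S i top c∈ c≢x) a∈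
    blocked-dmid {i} {x} {s} {inp} {S} wf top (stacked j l l≤j c∈ a∈) with c ≟ x | a ≟ x
    ... | yes refl | _ =
      stacked (suc i) l (i≤inject₁[j]⇒i≤1+j (subst (λ j → toℕ l ≤ toℕ j) c-at-i l≤j))
              (∈-transferred S i) (∈-transfer S i top a∈ (c≢a ∘ sym))
      where
      c-at-i : j ≡ inject₁ i
      c-at-i = stack-position S j (inject₁ i) (stacks-distinct wf) c∈
                 (subst (c ∈_) (sym top) (here refl))
    ... | no c≢x | no a≢x =
      stacked j l l≤j (∈-transfer S i top c∈ c≢x) (∈-transfer S i top a∈ a≢x)
    ... | no c≢x | yes refl = advance (m≤n⇒m<n∨m≡n (subst (_≤ toℕ j) l≡i l≤j))
      where
      l≡i : toℕ l ≡ toℕ i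
      l≡i = trans (cong toℕ (stack-position S l (inject₁ i) (stacks-distinct wf) a∈
                               (subst (a ∈_) (sym top) (here refl))))
                  (toℕ-inject₁ i)
      advance : toℕ i < toℕ j ⊎ toℕ i ≡ toℕ j → Blocked inp (transfer S i a s)
      advance (inj₁ i<j) = stacked j (suc i) i<j (∈-transfer S i top c∈ c≢x) (∈-transferred S i)
      advance (inj₂ i≡j) = ⊥-elim (a-not-above-c (decreasing wf (inject₁ i)) top c∈Di refl)
        where
        c∈Di : c ∈ lookup S (inject₁ i)
        c∈Di = subst (λ j → c ∈ lookup S j)
                     (toℕ-injective (trans (sym i≡j) (sym (toℕ-inject₁ i)))) c∈

    -- d_k moves the top x of D_k to I.  Provided x ≠ c, the configuration stays
    -- blocked: x = a would put a on top of c, both being in the last stack.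
    blocked-dk : ∀ {x s inp S Is o} → WellFormed (config inp S Is o) →
                 lookup S (fromℕ m) ≡ x ∷ s → c ≢ x →
                 Blocked inp S → Blocked inp (S [ fromℕ m ]≔ s)
    blocked-dk _ _ _ (ordered xs ys zs e) = ordered xs ys zs e
    blocked-dk {S = S} _ top c≢x (queued j c∈ a∈) = queued j (∈-pop S (fromℕ m) top c∈ c≢x) a∈
    blocked-dk {x} {S = S} wf top c≢x (stacked j l l≤j c∈ a∈) with a ≟ x
    ... | no a≢x   =
      stacked j l l≤j (∈-pop S (fromℕ m) top c∈ c≢x) (∈-pop S (fromℕ m) top a∈ a≢x)
    ... | yes refl =
      ⊥-elim (a-not-above-c (decreasing wf (fromℕ m)) top (subst (λ j → c ∈ lookup S j) j-last c∈) refl)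
      where
      l-last : l ≡ fromℕ m
      l-last = stack-position S l (fromℕ m) (stacks-distinct wf) a∈
                 (subst (a ∈_) (sym top) (here refl))
      j-last : j ≡ fromℕ m
      j-last = toℕ-injective (≤-antisym (≤fromℕ j) (subst (λ l → toℕ l ≤ toℕ j) l-last l≤j))

    Hypothesis : Config m → Set
    Hypothesis C₀ =
      (∃[ j ] ∃[ l ] (toℕ l ≤ toℕ j × c ∈ lookup (D C₀) j × a ∈ lookup (D C₀) l))
      ⊎ (∃[ j ] (c ∈ lookup (D C₀) j × a ∈ input C₀))
      ⊎ (c ∈ input C₀ × a ∈ input C₀ ×
         ∃[ xs ] ∃[ ys ] ∃[ zs ] (π ≡ xs ++ c ∷ ys ++ a ∷ zs))

    -- The hypotheses say that C₀ is blocked; in case (3) c precedes a in π,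
    -- hence in the unread suffix of π, as the read prefix does not contain c.
    hypothesis-blocked : ∀ {C₀} → Unique π → WellFormed C₀ → Hypothesis C₀ →
                         Blocked (input C₀) (D C₀)
    hypothesis-blocked _ _ (inj₁ (j , l , l≤j , c∈ , a∈))  = stacked j l l≤j c∈ a∈
    hypothesis-blocked _ _ (inj₂ (inj₁ (j , c∈ , a∈)))     = queued j c∈ a∈
    hypothesis-blocked distinct-π wf (inj₂ (inj₂ (c∈input , _ , xs , ys , zs , π≡)))
      with consumed wf
    ... | p , p++input≡π with suffix-split p xs (trans p++input≡π π≡) c∉p
      where
      c∉p : c ∉ p
      c∉p c∈p = unique-disjoint p (subst Unique (sym p++input≡π) distinct-π) c∈p c∈input
    ...   | xs′ , input≡ = ordered xs′ ys zs input≡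

    record Invariant (C : Config m) : Set where
      constructor invariant
      field
        well-formed : WellFormed C
        b-in-I      : b ∈ I C
        blocked     : Blocked (input C) (D C)

    start : ∀ {C₀ C₁ : Config m} → Unique π → WellFormed C₀ → Step π dk C₀ C₁ →
            ∃[ s ] (lookup (D C₀) (fromℕ m) ≡ b ∷ s) → Hypothesis C₀ → Invariant C₁
    start distinct-π wf st@(stepK {x} top _) (_ , b-on-top) hyp =
      invariant (step-wf wf st) (here (sym x≡b))
                (blocked-dk wf top c≢x (hypothesis-blocked distinct-π wf hyp))
      where
      x≡b : x ≡ b
      x≡b = ∷-injectiveˡ (trans (sym top) b-on-top)
      c≢x : c ≢ x
      c≢x c≡x = <-irrefl (sym (trans c≡x x≡b)) b<c

    preserved : ∀ {op} {C C′ : Config m} → Invariant C → Step π op C C′ →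
                Invariant C′ ⊎ (out C′ ≡ out C ++ [ b ] × Pending C a)
    preserved (invariant wf b∈I bl) st@(step0 _) =
      inj₁ (invariant (step-wf wf st) b∈I (blocked-d0 bl))
    preserved (invariant wf b∈I bl) st@(stepMid top _) =
      inj₁ (invariant (step-wf wf st) b∈I (blocked-dmid wf top bl))
    preserved (invariant wf b∈I bl) st@(stepK {x} top x-fits) =
      inj₁ (invariant (step-wf wf st) (there b∈I) (blocked-dk wf top c≢x bl))
      where
      c≢x : c ≢ x
      c≢x c≡x = <-asym b<c (subst (_< b) (sym c≡x) (canPushI⇒< (increasing wf) x-fits b∈I))
    preserved (invariant wf (there b∈I) bl) st@(stepOut _) =
      inj₁ (invariant (step-wf wf st) b∈I bl)
    preserved {C = C} (invariant wf (here b≡x) bl) (stepOut {o = o} _) =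
      inj₂ (cong (λ y → o ++ [ y ]) (sym b≡x) , a-pending C bl)

    -- From a configuration satisfying the invariant no run outputs 1 2 ⋯ n:
    -- outputting b first would skip the pending a < b, and otherwise c stays pending.
    never-sorted : ∀ n {C C₂ : Config m} → a ∈ idPerm n → c ∈ idPerm n → Invariant C →
                   Run π C C₂ → out C₂ ≢ idPerm n
    never-sorted n {C} _ c∈ (invariant wf _ bl) ε done =
      pending-not-output wf (c-pending C bl) (subst (c ∈_) (sym done) c∈)
    never-sorted n {C} a∈ c∈ inv ((_ , st) ◅ run) done with preserved inv st
    ... | inj₁ inv′ = never-sorted n a∈ c∈ inv′ run done
    ... | inj₂ (emits-b , a-pend) with run-extends-output run
    ...   | t , grows =
      pending-not-output (Invariant.well-formed inv) a-pend
        (smaller-output-first {n} (out C) (trans (cong (_++ t) (sym emits-b)) (trans grows done))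
                              a∈ a<b)

lemma2 : (m n : ℕ) (π : List ℕ) → π ↭ idPerm n →
    (a b c : ℕ) → a ∈ π → b ∈ π → c ∈ π → a < b → b < c →
    (C₀ C₁ : Config m) → Run π (initial m π) C₀ →
    Step π dk C₀ C₁ → (∃[ s ] (lookup (D C₀) (fromℕ m) ≡ b ∷ s)) →
    ((∃[ j ] ∃[ l ] (toℕ l ≤ toℕ j × c ∈ lookup (D C₀) j × a ∈ lookup (D C₀) l))
    ⊎ (∃[ j ] (c ∈ lookup (D C₀) j × a ∈ input C₀))
    ⊎ (c ∈ input C₀ × a ∈ input C₀ ×
    ∃[ xs ] ∃[ ys ] ∃[ zs ] (π ≡ xs ++ c ∷ ys ++ a ∷ zs))) →
    ¬ (∃[ C₂ ] (Run π C₁ C₂ × out C₂ ≡ idPerm n))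
lemma2 m n π π↭id a b c a∈π _ c∈π a<b b<c C₀ C₁ run₀ b-to-I b-on-top hyp (C₂ , run₁ , sorted) =
  never-sorted n (∈-resp-↭ π↭id a∈π) (∈-resp-↭ π↭id c∈π)
    (start distinct-π (run-wf (initial-wf distinct-π) run₀) b-to-I b-on-top hyp) run₁ sorted
  where
  open Machine m π
  open Pattern a<b b<c
  distinct-π : Unique π
  distinct-π = unique-resp-↭ (↭-sym π↭id) (idPerm-unique n)
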